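{- For every program $P$ and every state $s\in S$, the set $\{\mu \mid \langle P,s\rangle \longrightarrow \mu\}$ is finite.
   Context: Fix a set $S$ of states, a set of atomic programs $\mathtt{a}$ and a set of conditions $\mathtt{b}$. Programs are given by the grammar $P ::= \mathtt{skip} \mid \mathtt{a} \mid P;P \mid P\parallel P \mid P +_{\mathtt{p}} P \mid P + P \mid \mathtt{if}\ \mathtt{b}\ \mathtt{then}\ P\ \mathtt{else}\ P \mid \mathtt{while}\ \mathtt{b}\ P$, with $\mathtt{p}\in[0,1]\cap\mathbb{Q}$; $\mathrm{Pr}$ denotes the set of programs. For a set $Y$, $\mathcal{V}_{=1,\omega}(Y)$ denotes the finitely supported probability distributions on $Y$, written as finite combinations $\sum_i r_i\cdot y_i$ (meaning $\sum_i r_i\delta_{y_i}$). Each atomic program has an interpretation $[\![\mathtt{a}]\!]:S\to\mathcal{V}_{=1,\omega}(S)$ and each condition $[\![\mathtt{b}]\!]:S\to\{\mathtt{tt},\mathtt{ff}\}$. A pair $\langle P,s\rangle$ is a configuration. Every element of $\mathcal{V}_{=1,\omega}(S+\mathrm{Pr}\times S)$ is written $\sum_i p_i\cdot\langle P_i,s_i\rangle+\sum_j p_j\cdot s_j$. The small-step relation $\longrightarrow\ \subseteq(\mathrm{Pr}\times S)\times\mathcal{V}_{=1,\omega}(S+\mathrm{Pr}\times S)$ is the least relation closed under the rules: $\langle\mathtt{a},s\rangle\longrightarrow[\![\mathtt{a}]\!](s)$; $\langle\mathtt{skip},s\rangle\longrightarrow 1\cdot s$; if $\langle P,s\rangle\longrightarrow\sum_ip_i\cdot\langle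 P_i,s_i\rangle+\sum_jp_j\cdot s_j$ then $\langle P;Q,s\rangle\longrightarrow\sum_ip_i\cdot\langle P_i;Q,s_i\rangle+\sum_jp_j\cdot\langle Q,s_j\rangle$ and $\langle P\parallel Q,s\rangle\longrightarrow\sum_ip_i\cdot\langle P_i\parallel Q,s_i\rangle+\sum_jp_j\cdot\langle Q,s_j\rangle$; if $\langle Q,s\rangle\longrightarrow\sum_ip_i\cdot\langle Q_i,s_i\rangle+\sum_jp_j\cdot s_j$ then $\langle P\parallel Q,s\rangle\longrightarrow\sum_ip_i\cdot\langle P\parallel Q_i,s_i\rangle+\sum_jp_j\cdot\langle P,s_j\rangle$; if $\langle P,s\rangle\longrightarrow\mu$ and $\langle Q,s\rangle\longrightarrow\nu$ then $\langle P+_{\mathtt{p}}Q,s\rangle\longrightarrow\mathtt{p}\cdot\mu+(1-\mathtt{p})\cdot\nu$; if $\langle P,s\rangle\longrightarrow\mu$ or $\langle Q,s\rangle\longrightarrow\mu$ then $\langle P+Q,s\rangle\longrightarrow\mu$; $\langle\mathtt{if}\ \mathtt{b}\ \mathtt{then}\ P\ \mathtt{else}\ Q,s\rangle\longrightarrow1\cdot\langle P,s\rangle$ if $[\![\mathtt{b}]\!](s)=\mathtt{tt}$ and $\longrightarrow1\cdot\langle Q,s\rangle$ if $[\![\mathtt{b}]\!](s)=\mathtt{ff}$; $\langle\mathtt{while}\ \mathtt{b}\ P,s\rangle\longrightarrow1\cdot\langle P;\mathtt{while}\ \mathtt{b}\ P,s\rangle$ if $[\![\mathtt{b}]\!](s)=\mathtt{tt}$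 and $\longrightarrow 1\cdot s$ if $[\![\mathtt{b}]\!](s)=\mathtt{ff}$. -}

module Defs where

open import Data.Bool using (Bool; true; false)
open import Data.Product using (_×_; _,_)
open import Data.Sum using (_⊎_; inj₁; inj₂)
open import Data.List using (List; []; _∷_; map; _++_)
open import Relation.Binary.PropositionalEquality using (_≡_)
open import Data.Rational using (ℚ; 0ℚ; 1ℚ; _-_; _≤_)

-- Weights (coefficients) of finite formal combinations.  The paper uses real
-- numbers; we allow any carrier with a multiplication and an embedding of the
-- rationals (so ℝ is an instance).
record Weights : Set₁ where
  field
    Carrier : Set
    _*_     : Carrier → Carrier → Carrier
    fromℚ   : ℚ → Carrier

-- Programs over atomic programs A and conditions B.
-- prob p _ _ P Q  is  P +_p Q  with p ∈ [0,1] ∩ ℚ;  P ⊕ Q is  P + Q.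
module Syntax (A B : Set) where

  infixr 5 _⨾_
  infixr 4 _∥_
  data Prog : Set where
    skip  : Prog
    atom  : A → Prog
    _⨾_   : Prog → Prog → Prog
    _∥_   : Prog → Prog → Prog
    prob  : (p : ℚ) → 0ℚ ≤ p → p ≤ 1ℚ → Prog → Prog → Prog
    _⊕_   : Prog → Prog → Prog
    if_then_else_ : B → Prog → Prog → Prog
    while : B → Prog → Prog

-- Finitely supported distributions V(X), represented as finite formal
-- combinations  Σ_i r_i · x_i  (lists of (weight, element)).
FDist : Weights → Set → Set
FDist W X = List (Weights.Carrier W × X)

module Semantics (W : Weights) (S A B : Set)
                 (⟦_⟧a : A → S → FDist W S)
                 (⟦_⟧b : B → S → Bool) where
  open Weights W
  open Syntax A B public

  Out : Set
  Out = S ⊎ (Prog × S)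

  Dist : Set
  Dist = FDist W Out

  mapD : {X Y : Set} → (X → Y) → FDist W X → FDist W Y
  mapD f = map (λ { (r , x) → (r , f x) })

  scale : Carrier → Dist → Dist
  scale q = map (λ { (r , x) → (q * r , x) })

  -- Σ_i p_i⟨P_i,s_i⟩ + Σ_j p_j s_j  ↦  Σ_i p_i⟨P_i;Q,s_i⟩ + Σ_j p_j⟨Q,s_j⟩
  seqK : Prog → Out → Out
  seqK Q (inj₁ t)        = inj₂ (Q , t)
  seqK Q (inj₂ (P' , t)) = inj₂ ((P' ⨾ Q) , t)

  parL : Prog → Out → Out
  parL Q (inj₁ t)        = inj₂ (Q , t)
  parL Q (inj₂ (P' , t)) = inj₂ ((P' ∥ Q) , t)

  parR : Prog → Out → Out
  parR P (inj₁ t)        = inj₂ (P , t)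
  parR P (inj₂ (Q' , t)) = inj₂ ((P ∥ Q') , t)

  one : Carrier
  one = fromℚ 1ℚ

  data _⟶_ : Prog × S → Dist → Set where
    ⟶atom  : ∀ {a s} → (atom a , s) ⟶ mapD inj₁ (⟦ a ⟧a s)
    ⟶skip  : ∀ {s} → (skip , s) ⟶ ((one , inj₁ s) ∷ [])
    ⟶seq   : ∀ {P Q s μ} → (P , s) ⟶ μ → ((P ⨾ Q) , s) ⟶ mapD (seqK Q) μ
    ⟶parL  : ∀ {P Q s μ} → (P , s) ⟶ μ → ((P ∥ Q) , s) ⟶ mapD (parL Q) μ
    ⟶parR  : ∀ {P Q s μ} → (Q , s) ⟶ μ → ((P ∥ Q) , s) ⟶ mapD (parR P) μ
    ⟶prob  : ∀ {P Q s μ ν p} {h₀ : 0ℚ ≤ p} {h₁ : p ≤ 1ℚ} →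
             (P , s) ⟶ μ → (Q , s) ⟶ ν →
             (prob p h₀ h₁ P Q , s) ⟶ (scale (fromℚ p) μ ++ scale (fromℚ (1ℚ - p)) ν)
    ⟶ndL   : ∀ {P Q s μ} → (P , s) ⟶ μ → ((P ⊕ Q) , s) ⟶ μ
    ⟶ndR   : ∀ {P Q s μ} → (Q , s) ⟶ μ → ((P ⊕ Q) , s) ⟶ μ
    ⟶ifT   : ∀ {b P Q s} → ⟦ b ⟧b s ≡ true →
             ((if b then P else Q) , s) ⟶ ((one , inj₂ (P , s)) ∷ [])
    ⟶ifF   : ∀ {b P Q s} → ⟦ b ⟧b s ≡ false →
             ((if b then P else Q) , s) ⟶ ((one , inj₂ (Q , s)) ∷ [])
    ⟶whT   : ∀ {b P s} → ⟦ b ⟧b s ≡ true →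
             (while b P , s) ⟶ ((one , inj₂ ((P ⨾ while b P) , s)) ∷ [])
    ⟶whF   : ∀ {b P s} → ⟦ b ⟧b s ≡ false →
             (while b P , s) ⟶ ((one , inj₁ s) ∷ [])

-- Every rule with premises only asks for steps of immediate subprograms (the
-- unfolding of `while` is a premise-free rule), so the possible steps of
-- ⟨P , s⟩ can be listed by structural recursion on P: a sequential or
-- parallel context maps the lists of its components, nondeterministic choice
-- concatenates them, and probabilistic choice takes their cartesian product.

module Submission where

open import Defs
open import Data.Bool using (Bool; true; false)
open import Data.Product using (_×_; _,_; ∃)
open import Data.List using (List; [_]; map; _++_; cartesianProductWith)
open import Data.List.Membership.Propositional using (_∈_)
open import Data.List.Membership.Propositional.Properties
  using (∈-map⁺; ∈-++⁺ˡ; ∈-++⁺ʳ; ∈-cartesianProductWith⁺)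
open import Data.List.Relation.Unary.Any using (here)
open import Relation.Binary.PropositionalEquality using (refl)
open import Data.Sum using (inj₁; inj₂)
open import Data.Rational using (1ℚ; _-_)

module FiniteBranching (W : Weights) (S A B : Set)
                       (⟦_⟧a : A → S → FDist W S) (⟦_⟧b : B → S → Bool) where
  open Semantics W S A B ⟦_⟧a ⟦_⟧b
  open Weights W

  successors : Prog → S → List Dist
  successors skip s = [ [ one , inj₁ s ] ]
  successors (atom a) s = [ mapD inj₁ (⟦ a ⟧a s) ]
  successors (P ⨾ Q) s = map (mapD (seqK Q)) (successors P s)
  successors (P ∥ Q) s =
    map (mapD (parL Q)) (successors P s) ++ map (mapD (parR P)) (successors Q s)
  successors (prob p _ _ P Q) s =
    cartesianProductWith (λ μ ν → scale (fromℚ p) μ ++ scale (fromℚ (1ℚ - p)) ν)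
                         (successors P s) (successors Q s)
  successors (P ⊕ Q) s = successors P s ++ successors Q s
  successors (if b then P else Q) s with ⟦ b ⟧b s
  ... | true  = [ [ one , inj₂ (P , s) ] ]
  ... | false = [ [ one , inj₂ (Q , s) ] ]
  successors (while b P) s with ⟦ b ⟧b s
  ... | true  = [ [ one , inj₂ ((P ⨾ while b P) , s) ] ]
  ... | false = [ [ one , inj₁ s ] ]

  ⟶⇒∈-successors : ∀ {P s μ} → (P , s) ⟶ μ → μ ∈ successors P s
  ⟶⇒∈-successors ⟶atom = here refl
  ⟶⇒∈-successors ⟶skip = here refl
  ⟶⇒∈-successors (⟶seq {Q = Q} d) = ∈-map⁺ (mapD (seqK Q)) (⟶⇒∈-successors d)
  ⟶⇒∈-successors (⟶parL {Q = Q} d) =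
    ∈-++⁺ˡ (∈-map⁺ (mapD (parL Q)) (⟶⇒∈-successors d))
  ⟶⇒∈-successors (⟶parR {P = P} d) =
    ∈-++⁺ʳ _ (∈-map⁺ (mapD (parR P)) (⟶⇒∈-successors d))
  ⟶⇒∈-successors (⟶prob d e) =
    ∈-cartesianProductWith⁺ _ (⟶⇒∈-successors d) (⟶⇒∈-successors e)
  ⟶⇒∈-successors (⟶ndL d) = ∈-++⁺ˡ (⟶⇒∈-successors d)
  ⟶⇒∈-successors (⟶ndR d) = ∈-++⁺ʳ _ (⟶⇒∈-successors d)
  ⟶⇒∈-successors (⟶ifT b≡true)  rewrite b≡true  = here refl
  ⟶⇒∈-successors (⟶ifF b≡false) rewrite b≡false = here refl
  ⟶⇒∈-successors (⟶whT b≡true)  rewrite b≡true  = here refl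
  ⟶⇒∈-successors (⟶whF b≡false) rewrite b≡false = here refl

theorem3p1 : (W : Weights) (S A B : Set)
             (⟦_⟧a : A → S → FDist W S) (⟦_⟧b : B → S → Bool) →
             let open Semantics W S A B ⟦_⟧a ⟦_⟧b in
             (P : Prog) (s : S) →
             ∃ λ (L : List Dist) → ∀ (μ : Dist) → (P , s) ⟶ μ → μ ∈ L
theorem3p1 W S A B ⟦_⟧a ⟦_⟧b P s =
  successors P s , λ _ → ⟶⇒∈-successors
  where open FiniteBranching W S A B ⟦_⟧a ⟦_⟧b
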